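{- Let $G$ be a simple graph of order $n\ge2$ and let $t\ge 3$. If two contracted vertices are adjacent in $S[G,t]$, then at least one of them is a contracted vertex at step $2$.
   Context: Let $G$ be a simple graph with vertex set $V=\{1,\dots,n\}$, $n\ge 2$. For $t\ge 1$, the generalized Sierpiński graph $S(G,t)$ has vertex set $V^t$ (words $u_1u_2\cdots u_t$ over $V$), and two words ${\bf u}=u_1\cdots u_t$, ${\bf v}=v_1\cdots v_t$ are adjacent iff there is $i\in\{1,\dots,t\}$ with $u_j=v_j$ for $j<i$, $u_i\neq v_i$ and $u_iv_i\in E(G)$, and $u_j=v_i$, $v_j=u_i$ for all $j>i$. An edge of this kind with $i<t$ is called a linking edge; it joins $w\,ab\cdots b$ and $w\,ba\cdots a$ where $w$ is a word of length $r=i-1\le t-2$ and $ab\in E(G)$, and it is said to appear at step $t-r$. The linking edges form a matching. The generalized Sierpiński gasket $S[G,t]$ is the graph obtained from $S(G,t)$ by contracting all linking edges. The vertex of $S[G,t]$ obtained by contracting the linking edge between $w\,ab\cdots b$ and $w\,ba\cdots a$ (with $|w|=r$) is denoted $w\{a,b\}_{t-r}$ and is called a contracted vertex at step $t-r$. -}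

module Defs where

open import Data.Nat using (ℕ; zero; suc; _+_; _≤_)
open import Data.Fin using (Fin)
open import Data.Vec using (Vec; _++_; _∷_; replicate)
open import Data.Product using (Σ; _×_; ∃)
open import Data.Sum using (_⊎_)
open import Relation.Binary.PropositionalEquality using (_≡_)
open import Relation.Nullary using (¬_)

record SimpleGraph (n : ℕ) : Set₁ where
  field
    Adj   : Fin n → Fin n → Set
    sym   : ∀ {a b} → Adj a b → Adj b a
    irrefl : ∀ {a} → ¬ Adj a a
open SimpleGraph public

-- Words of length t over V = Fin n (vertices of S(G,t)).
Word : ℕ → ℕ → Set
Word n t = Vec (Fin n) t

-- Adjacency in S(G,t): u = w a b…b, v = w b a…a with |w| = r, ab ∈ E(G),
-- and k trailing letters, so t = r + suc k and the index i = r + 1.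
data SAdj {n : ℕ} (G : SimpleGraph n) : {t : ℕ} → Word n t → Word n t → Set where
  sedge : ∀ {r k} (w : Vec (Fin n) r) {a b : Fin n} → Adj G a b →
          SAdj G (w ++ (a ∷ replicate k b)) (w ++ (b ∷ replicate k a))

-- Linking edge appearing at step s = t - r (i < t, i.e. k ≥ 1, so s = suc k ≥ 2).
data LinkAt {n : ℕ} (G : SimpleGraph n) : {t : ℕ} → ℕ → Word n t → Word n t → Set where
  link : ∀ {r j} (w : Vec (Fin n) r) {a b : Fin n} → Adj G a b →
         LinkAt G (suc (suc j)) (w ++ (a ∷ replicate (suc j) b))
                                (w ++ (b ∷ replicate (suc j) a))

Linked : ∀ {n t} → SimpleGraph n → Word n t → Word n t → Set
Linked G u v = ∃ λ s → LinkAt G s u v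

-- The vertex of S[G,t] containing the word u (its class under contraction
-- of linking edges): x belongs to the class of u.
InClass : ∀ {n t} → SimpleGraph n → Word n t → Word n t → Set
InClass G u x = (x ≡ u) ⊎ (Linked G u x ⊎ Linked G x u)

SameVertex : ∀ {n t} → SimpleGraph n → Word n t → Word n t → Set
SameVertex {n} {t} G u v =
  (x : Word n t) → (InClass G u x → InClass G v x) × (InClass G v x → InClass G u x)

GasketAdj : ∀ {n t} → SimpleGraph n → Word n t → Word n t → Set
GasketAdj {n} {t} G u v =
  ¬ SameVertex G u v ×
  Σ (Word n t) λ x → Σ (Word n t) λ y → InClass G u x × InClass G v y × SAdj G x y

ContractedAt : ∀ {n t} → SimpleGraph n → ℕ → Word n t → Set
ContractedAt {n} {t} G s u = Σ (Word n t) λ u' → LinkAt G s u u'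

{-# OPTIONS --safe #-}
-- Linking edges form a matching, so a vertex of S[G,t] is a word together with its
-- linking partner, if it has one. If the S(G,t)-edge between representatives of two
-- distinct vertices were a linking edge, the two vertices would coincide; hence it is an
-- edge w a — w b changing only the last letter, with a ≠ b. But both representatives
-- w a b…b and w b a…a of a contracted vertex at step s ≥ 3 end in a repeated letter,
-- and w a and w b cannot both do so.
module Submission where

open import Defs hiding (sym)
open import Data.Nat using (ℕ; zero; suc; _≤_; _≟_)
open import Data.Fin using (Fin)
open import Data.List using (List; _∷_; _++_; _∷ʳ_; [_]; reverse; replicate)
open import Data.List.Properties
  using (∷-injectiveˡ; ∷-injectiveʳ; ++-assoc; unfold-reverse; reverse-++; reverse-injective)
open import Data.Vec as Vec using (Vec; toList)
open import Data.Vec.Properties using (toList-++; toList-replicate; toList-injective; cast-is-id)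
open import Data.Product using (∃; _×_; _,_)
open import Data.Sum using (_⊎_; inj₁; inj₂)
open import Data.Empty using (⊥; ⊥-elim)
open import Function using (_∘_)
open import Relation.Nullary using (yes; no)
open import Relation.Binary.PropositionalEquality
  using (_≡_; _≢_; refl; sym; trans; cong; module ≡-Reasoning)
open ≡-Reasoning

module _ {A : Set} where

  replicate-∷ʳ : ∀ k (x : A) → replicate k x ∷ʳ x ≡ x ∷ replicate k x
  replicate-∷ʳ zero    x = refl
  replicate-∷ʳ (suc k) x = cong (x ∷_) (replicate-∷ʳ k x)

  reverse-replicate : ∀ k (x : A) → reverse (replicate k x) ≡ replicate k x
  reverse-replicate zero    x = refl
  reverse-replicate (suc k) x = begin
    reverse (replicate (suc k) x)  ≡⟨ unfold-reverse x (replicate k x) ⟩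
    reverse (replicate k x) ∷ʳ x   ≡⟨ cong (_∷ʳ x) (reverse-replicate k x) ⟩
    replicate k x ∷ʳ x             ≡⟨ replicate-∷ʳ k x ⟩
    replicate (suc k) x            ∎

  replicate-++-∷-injective : ∀ k k' {x y y'} {ys ys' : List A} → y ≢ x → y' ≢ x →
    replicate k x ++ y ∷ ys ≡ replicate k' x ++ y' ∷ ys' →
    k ≡ k' × y ≡ y' × ys ≡ ys'
  replicate-++-∷-injective zero     zero     _   _    refl = refl , refl , refl
  replicate-++-∷-injective zero     (suc _)  y≢x _    refl = ⊥-elim (y≢x refl)
  replicate-++-∷-injective (suc _)  zero     _   y'≢x refl = ⊥-elim (y'≢x refl)
  replicate-++-∷-injective (suc k)  (suc k') y≢x y'≢x eq
    with replicate-++-∷-injective k k' y≢x y'≢x (∷-injectiveʳ eq)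
  ... | refl , refl , refl = refl , refl , refl

module _ {n : ℕ} where

  private variable
    t s : ℕ
    p q q' u u' v x y : Word n t

  -- Words are read from their last letter, where all linking edges act.
  backwards : Word n t → List (Fin n)
  backwards x = reverse (toList x)

  backwards-injective : backwards x ≡ backwards y → x ≡ y
  backwards-injective {x = x} {y = y} eq =
    trans (sym (cast-is-id refl x)) (toList-injective refl x y (reverse-injective eq))

  backwards-++-∷-replicate : ∀ {r} k (w : Vec (Fin n) r) (a b : Fin n) →
    backwards (w Vec.++ a Vec.∷ Vec.replicate k b) ≡ replicate k b ++ a ∷ backwards w
  backwards-++-∷-replicate k w a b = begin
    reverse (toList (w Vec.++ a Vec.∷ Vec.replicate k b))
      ≡⟨ cong reverse (toList-++ w (a Vec.∷ Vec.replicate k b)) ⟩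
    reverse (toList w ++ a ∷ toList (Vec.replicate k b))
      ≡⟨ cong (λ bs → reverse (toList w ++ a ∷ bs)) (toList-replicate k b) ⟩
    reverse (toList w ++ a ∷ replicate k b)
      ≡⟨ reverse-++ (toList w) (a ∷ replicate k b) ⟩
    reverse (a ∷ replicate k b) ++ backwards w
      ≡⟨ cong (_++ backwards w) (unfold-reverse a (replicate k b)) ⟩
    (reverse (replicate k b) ∷ʳ a) ++ backwards w
      ≡⟨ cong (λ bs → (bs ∷ʳ a) ++ backwards w) (reverse-replicate k b) ⟩
    (replicate k b ∷ʳ a) ++ backwards w
      ≡⟨ ++-assoc (replicate k b) [ a ] (backwards w) ⟩
    replicate k b ++ a ∷ backwards w
      ∎

  record Swapped (p q : Word n t) : Set where
    constructor swapped
    field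
      {k}    : ℕ
      {a b}  : Fin n
      {rest} : List (Fin n)
      a≢b     : a ≢ b
      p-shape : backwards p ≡ replicate (suc k) b ++ a ∷ rest
      q-shape : backwards q ≡ replicate (suc k) a ++ b ∷ rest

  Swapped-sym : Swapped p q → Swapped q p
  Swapped-sym (swapped a≢b p-shape q-shape) = swapped (a≢b ∘ sym) q-shape p-shape

  Swapped-functional : Swapped p q → Swapped p q' → q ≡ q'
  Swapped-functional (swapped {k} a≢b p-shape q-shape)
                     (swapped {k'} a'≢b' p-shape' q'-shape)
    with ∷-injectiveˡ (trans (sym p-shape) p-shape')
  ... | refl
    with replicate-++-∷-injective (suc k) (suc k') a≢b a'≢b' (trans (sym p-shape) p-shape')
  ... | refl , refl , refl = backwards-injective (trans q-shape (sym q'-shape))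

  EndsWithRepeat : Word n t → Set
  EndsWithRepeat x = ∃ λ c → ∃ λ rest → backwards x ≡ c ∷ c ∷ rest

  module _ (G : SimpleGraph n) where

    Adj⇒≢ : ∀ {a b} → Adj G a b → a ≢ b
    Adj⇒≢ ab refl = irrefl G ab

    LinkAt⇒Swapped : LinkAt G s p q → Swapped p q
    LinkAt⇒Swapped (link {j = j} w {a} {b} ab) =
      swapped (Adj⇒≢ ab) (backwards-++-∷-replicate (suc j) w a b)
                         (backwards-++-∷-replicate (suc j) w b a)

    LinkAt⇒EndsWithRepeat : s ≢ 2 → LinkAt G s p q → EndsWithRepeat p × EndsWithRepeat q
    LinkAt⇒EndsWithRepeat s≢2 (link {j = zero} _ _) = ⊥-elim (s≢2 refl)
    LinkAt⇒EndsWithRepeat _ (link {j = suc j} w {a} {b} ab) =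
      (b , _ , backwards-++-∷-replicate (suc (suc j)) w a b) ,
      (a , _ , backwards-++-∷-replicate (suc (suc j)) w b a)

    Joined : Word n t → Word n t → Set
    Joined p q = Linked G p q ⊎ Linked G q p

    Joined-sym : Joined p q → Joined q p
    Joined-sym (inj₁ pq) = inj₂ pq
    Joined-sym (inj₂ qp) = inj₁ qp

    Joined⇒Swapped : Joined p q → Swapped p q
    Joined⇒Swapped (inj₁ (_ , pq)) = LinkAt⇒Swapped pq
    Joined⇒Swapped (inj₂ (_ , qp)) = Swapped-sym (LinkAt⇒Swapped qp)

    Joined-functional : Joined p q → Joined p q' → q ≡ q'
    Joined-functional pq pq' = Swapped-functional (Joined⇒Swapped pq) (Joined⇒Swapped pq')

    InClass-sym : InClass G u x → InClass G x u
    InClass-sym (inj₁ refl) = inj₁ refl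
    InClass-sym (inj₂ ux)   = inj₂ (Joined-sym ux)

    InClass-trans : InClass G u x → InClass G x y → InClass G u y
    InClass-trans (inj₁ refl) xy          = xy
    InClass-trans (inj₂ ux)   (inj₁ refl) = inj₂ ux
    InClass-trans (inj₂ ux)   (inj₂ xy)   = inj₁ (Joined-functional xy (Joined-sym ux))

    InClass⇒SameVertex : InClass G u v → SameVertex G u v
    InClass⇒SameVertex uv _ = InClass-trans (InClass-sym uv) , InClass-trans uv

    InClass-LinkAt : LinkAt G s u u' → InClass G u x → x ≡ u ⊎ x ≡ u'
    InClass-LinkAt _  (inj₁ x≡u) = inj₁ x≡u
    InClass-LinkAt uu' (inj₂ ux)  = inj₂ (Joined-functional ux (inj₁ (_ , uu')))

    ContractedAt-InClass⇒EndsWithRepeat :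
      s ≢ 2 → ContractedAt G s u → InClass G u x → EndsWithRepeat x
    ContractedAt-InClass⇒EndsWithRepeat s≢2 (_ , uu') ux
      with InClass-LinkAt uu' ux | LinkAt⇒EndsWithRepeat s≢2 uu'
    ... | inj₁ refl | u-repeats , _  = u-repeats
    ... | inj₂ refl | _ , u'-repeats = u'-repeats

    record LastLetterEdge (x y : Word n t) : Set where
      constructor lastLetterEdge
      field
        {a b}   : Fin n
        {rest}  : List (Fin n)
        ab      : Adj G a b
        x-shape : backwards x ≡ a ∷ rest
        y-shape : backwards y ≡ b ∷ rest

    SAdj⇒Linked⊎LastLetterEdge : SAdj G x y → Linked G x y ⊎ LastLetterEdge x y
    SAdj⇒Linked⊎LastLetterEdge (sedge {k = zero} w {a} {b} ab) =
      inj₂ (lastLetterEdge ab (backwards-++-∷-replicate 0 w a b)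
                              (backwards-++-∷-replicate 0 w b a))
    SAdj⇒Linked⊎LastLetterEdge (sedge {k = suc j} w ab) = inj₁ (_ , link w ab)

    LastLetterEdge⇒¬bothEndWithRepeat :
      LastLetterEdge x y → EndsWithRepeat x → EndsWithRepeat y → ⊥
    LastLetterEdge⇒¬bothEndWithRepeat (lastLetterEdge ab x-shape y-shape)
                                      (_ , _ , x-repeats) (_ , _ , y-repeats)
      with trans (sym x-shape) x-repeats | trans (sym y-shape) y-repeats
    ... | refl | refl = irrefl G ab

mainTheorem10 : (n : ℕ) → 2 ≤ n → (G : SimpleGraph n) → (t : ℕ) → 3 ≤ t →
    (u v : Word n t) (s₁ s₂ : ℕ) →
    ContractedAt G s₁ u → ContractedAt G s₂ v → GasketAdj G u v →
    (s₁ ≡ 2) ⊎ (s₂ ≡ 2)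
mainTheorem10 _ _ G _ _ _ _ s₁ s₂ u-contracted v-contracted (u≉v , x , y , ux , vy , xy)
  with s₁ ≟ 2 | s₂ ≟ 2
... | yes s₁≡2 | _        = inj₁ s₁≡2
... | no _     | yes s₂≡2 = inj₂ s₂≡2
... | no s₁≢2  | no s₂≢2  with SAdj⇒Linked⊎LastLetterEdge G xy
...   | inj₁ x-linked-y =
  ⊥-elim (u≉v (InClass⇒SameVertex G
    (InClass-trans G ux (InClass-trans G (inj₂ (inj₁ x-linked-y)) (InClass-sym G vy)))))
...   | inj₂ last-letter-edge =
  ⊥-elim (LastLetterEdge⇒¬bothEndWithRepeat G last-letter-edge
    (ContractedAt-InClass⇒EndsWithRepeat G s₁≢2 u-contracted ux)
    (ContractedAt-InClass⇒EndsWithRepeat G s₂≢2 v-contracted vy))
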